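{- Let $\Pi$ be a program (in the sense of the context). If every aggregate literal that is recursive with respect to $\Pi$ is positive, then the FLP-stable models of $\Pi$ are the same as the FT-stable models of $\Pi$.
   Context: \textbf{Infinitary formulas.} For a set $\sigma$ of propositional atoms, let $\mathcal F_0=\sigma$ and let $\mathcal F_{i+1}$ be obtained from $\mathcal F_i$ by adding $\mathcal H^\land$ and $\mathcal H^\lor$ for all subsets $\mathcal H\subseteq\mathcal F_i$ and $F\to G$ for all $F,G\in\mathcal F_i$; formulas are the elements of $\bigcup_i\mathcal F_i$. $\top=\emptyset^\land$, $\bot=\emptyset^\lor$, $\neg F = F\to\bot$. Interpretations are subsets $I\subseteq\sigma$; $I\models p$ iff $p\in I$; $I\models\mathcal H^\land$ iff $I$ satisfies every member; $I\models\mathcal H^\lor$ iff $I$ satisfies some member; $I\models F\to G$ iff $I\not\models F$ or $I\models G$. \textbf{FLP-stable models of formulas.} For a set $\mathcal H$ of formulas $G\to H$ with $H$ a disjunction of atoms, the FLP-reduct $FLP(\mathcal H,I)$ is the set of those $G\to H$ in $\mathcal H$ with $I\models G$; $I$ is an FLP-stable model of $\mathcal H$ if it is a $\subseteq$-minimal model of $FLP(\mathcal H,I)$. \textbf{FT-stable models of formulas.} $FT(p,I)=p$ if $p\in I$ and $\bot$ otherwise; $FT(\mathcal H^\land,I)=\{FT(G,I):G\in\mathcal H\}^\land$; similarly for $\lor$; $FT(G\to H,I)=\bot$ if $I\not\models G\to H$, otherwise $FT(G,I)\to FT(H,I)$. For a set of formulas the reduct is taken elementwise; $I$ is an FT-stable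 model of $\mathcal H$ if it is a $\subseteq$-minimal model of $FT(\mathcal H,I)$. \textbf{Syntax of programs.} There are pairwise disjoint sets of numerals (in a fixed bijection $n\mapsto\overline n$ with $\mathbb Z$), symbolic constants, and variables, plus the symbols $+,-,\times,/$, $\mathit{inf},\mathit{sup}$, comparison symbols $=,\neq,<,>,\le,\ge$, and aggregate names $\mathit{count},\mathit{sum},\mathit{max},\mathit{min}$. Terms: numerals, symbolic constants, variables, $\mathit{inf}$, $\mathit{sup}$; $f(\mathbf t)$ for a symbolic constant $f$ and non-empty tuple $\mathbf t$ of terms; $(t_1\star t_2)$ for $\star\in\{+,-,\times,/\}$. A term is ground if it has no variables and precomputed if it has neither variables nor arithmetic operation symbols. Fix a total order on precomputed terms with least element $\mathit{inf}$, greatest element $\mathit{sup}$, and $\overline m\le\overline n$ iff $m\le n$. The weight of a tuple of precomputed terms is $n$ if its first member is $\overline n$, and $0$ otherwise. For a set $T$ of tuples of precomputed terms: $\widehat{count}(T)$ is $\overline{|T|}$ if $T$ is finite, else $\mathit{sup}$; $\widehat{sum}(T)$ is the numeral for the sum of weights if finitely many tuples have nonzero weight, else $\mathit{sup}$; $\widehat{min}(T)$ is $\mathit{sup}$ if $T=\emptyset$, the least first element of the tuples if $T$ finite non-empty, $\mathit{inf}$ if $T$ is infinite; $\widehat{max}(T)$ is $\mathit{inf}$ if $T=\emptyset$, the greatest first element if $T$ finite non-empty, $\mathit{sup}$ if infinite. An atom is $p(\mathbf t)$ with $p$ a symbolic constant and $\mathbf t$ a tuple of terms; symbolic literals are $A$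 and $\mathit{not}\ A$ for atoms $A$; arithmetic literals are $t_1\prec t_2$ with $\prec$ a comparison symbol; literals are symbolic or arithmetic literals. An aggregate atom is $\alpha\{\mathbf t:\mathbf L\}\prec s$ with $\alpha$ an aggregate name, $\mathbf t$ a tuple of terms, $\mathbf L$ a tuple of literals, $\prec$ a comparison symbol and $s$ a term; aggregate literals are $E$ (positive) and $\mathit{not}\ E$ (negative) for aggregate atoms $E$. A rule is $H_1\lor\dots\lor H_k\leftarrow B_1\land\dots\land B_n$ ($k,n\ge0$) with atoms $H_i$ and literals or aggregate literals $B_j$; a program is a finite set of rules. A variable is global in a symbolic/arithmetic literal if it occurs in it, in an aggregate atom or its negation if it occurs in $s$, in a rule if it is global in some $H_i$ or $B_j$. \textbf{Semantics of terms.} Numerals, symbolic constants, $\mathit{inf}$, $\mathit{sup}$ are well-formed with value themselves; $f(t_1,\dots,t_n)$ is well-formed if all $t_i$ are, with value $f(val(t_1),\dots,val(t_n))$; $(t_1+t_2)$, $(t_1-t_2)$, $(t_1\times t_2)$ are well-formed if $val(t_1)=\overline{n_1}$, $val(t_2)=\overline{n_2}$ are numerals, with value $\overline{n_1+n_2}$ etc.; $(t_1/t_2)$ is well-formed if moreover $n_2\ne0$, with value $\overline{\lfloor n_1/n_2\rfloor}$. Tuples are well-formed componentwise. A closed (no global variables) arithmetic literal $t_1\prec t_2$ is well-formed if $t_1,t_2$ are, and true if $val(t_1)\prec val(t_2)$; a closed symbolic literal is well-formed if its argument tuple is; a closed aggregate literal is well-formed if $s$ is. A tuple of well-formed literals is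 nontrivial if all arithmetic literals in it are true. \textbf{Translations.} Let $\sigma_0$ be the set of atoms $p(\mathbf t)$ with $\mathbf t$ precomputed. For $\tau'\in\{\tau,\tau_1\}$: $\tau'(p(\mathbf t))=p(val(\mathbf t))$, $\tau'(\mathit{not}\ p(\mathbf t))=\neg p(val(\mathbf t))$; for a nontrivial tuple $\mathbf L$ of well-formed literals/aggregate literals, $\tau'\mathbf L$ is the conjunction of $\tau' L$ over the symbolic and aggregate literals $L$ in $\mathbf L$. For a well-formed aggregate atom $E=\alpha\{\mathbf t:\mathbf L\}\prec s$, let $\mathbf x$ be the variables occurring in $\mathbf t:\mathbf L$ and $A$ the set of tuples $\mathbf r$ of precomputed terms such that $\mathbf t^{\mathbf x}_{\mathbf r}$ is well-formed and $\mathbf L^{\mathbf x}_{\mathbf r}$ is well-formed and nontrivial. For $\Delta\subseteq A$, $val(\Delta)=\{val(\mathbf t^{\mathbf x}_{\mathbf r}):\mathbf r\in\Delta\}$; $\Delta$ justifies $E$ if $\widehat\alpha(val(\Delta))\prec val(s)$. Then $\tau_1E$ is the disjunction over justifying $\Delta$ of $\bigwedge_{\mathbf r\in\Delta}\tau_1(\mathbf L^{\mathbf x}_{\mathbf r})\land\bigwedge_{\mathbf r\in A\setminus\Delta}\neg\tau_1(\mathbf L^{\mathbf x}_{\mathbf r})$, and $\tau E$ is the conjunction over non-justifying $\Delta$ of $\bigwedge_{\mathbf r\in\Delta}\tau(\mathbf L^{\mathbf x}_{\mathbf r})\to\bigvee_{\mathbf r\in A\setminus\Delta}\tau(\mathbf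 L^{\mathbf x}_{\mathbf r})$. $\tau'(\mathit{not}\ E)=\neg\tau' E$. For a rule $R$ with global variables $\mathbf x$, $\tau' R$ is the set of formulas $\tau'((B_1,\dots,B_n)^{\mathbf x}_{\mathbf r})\to\tau'(H_1)^{\mathbf x}_{\mathbf r}\lor\dots\lor\tau'(H_k)^{\mathbf x}_{\mathbf r}$ over all tuples $\mathbf r$ of precomputed terms such that $(B_1,\dots,B_n)^{\mathbf x}_{\mathbf r}$ is well-formed and nontrivial and all $(H_i)^{\mathbf x}_{\mathbf r}$ are well-formed; $\tau'\Pi=\bigcup_{R\in\Pi}\tau' R$. The FLP-stable models of $\Pi$ are the FLP-stable models of $\tau_1\Pi$; the FT-stable models of $\Pi$ are the FT-stable models of $\tau\Pi$ (interpretations of $\sigma_0$). \textbf{Recursion.} The predicate symbol of $p(t_1,\dots,t_n)$ is $p/n$. The predicate dependency graph of $\Pi$ has as vertices the predicate symbols of atoms occurring in $\Pi$ and an edge from $p/n$ to $q/m$ if some rule of $\Pi$ has an atom with symbol $p/n$ in its head and an atom with symbol $q/m$ in its body (including inside aggregates). An occurrence of an aggregate literal $L$ in a rule $R\in\Pi$ is recursive with respect to $\Pi$ if for some predicate symbol $p/n$ occurring in $L$ and some $q/m$ occurring in the head of $R$ there is a path from $p/n$ to $q/m$ in this graph. An aggregate literal is positive if it is an aggregate atom (not of the form $\mathit{not}\ E$) and all symbolic literals occurring in it are atoms (not of the form $\mathit{not}\ A$). -}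

module Defs where

open import Level using (0ℓ)
open import Data.Nat as ℕ using (ℕ; suc; _≡ᵇ_)
open import Data.Integer as ℤ using (ℤ; +_; -[1+_])
open import Data.Bool using (Bool; true; false; if_then_else_)
open import Data.List as List using (List; []; _∷_; length; lookup; deduplicate; _++_; concatMap; mapMaybe)
open import Data.Vec using (Vec; []; _∷_)
open import Data.Maybe as Maybe using (Maybe; just; nothing)
open import Data.Product using (Σ; _×_; _,_; proj₁)
open import Data.Sum using (_⊎_)
open import Data.Empty using (⊥; ⊥-elim)
open import Data.Unit using (⊤)
open import Data.Fin using (Fin)
open import Relation.Nullary using (¬_)
open import Relation.Binary.PropositionalEquality using (_≡_; _≢_)
open import Relation.Binary using (IsTotalOrder)
open import Data.List.Membership.Propositional using (_∈_)
open import Data.List.Relation.Unary.All using (All)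
open import Data.List.Relation.Unary.Unique.Propositional using (Unique)
open import Function.Bundles using (_⇔_)
open import Relation.Binary.Construct.Closure.ReflexiveTransitive using (Star)

-- Syntax.  Symbolic constants and variables are both indexed by ℕ
-- (two disjoint countably infinite sets, kept apart by constructors).

SymConst : Set
SymConst = ℕ

Variable : Set
Variable = ℕ

data ArOp : Set where
  plus minus times divide : ArOp

data Term : Set where
  num   : ℤ → Term
  const : SymConst → Term
  var   : Variable → Term
  inf   : Term
  sup   : Term
  app   : SymConst → Term → List Term → Term   -- f(t₁,…,tₙ), n ≥ 1
  arith : ArOp → Term → Term → Term

data PTerm : Set where
  pnum   : ℤ → PTerm
  pconst : SymConst → PTerm
  pinf   : PTerm
  psup   : PTerm
  papp   : SymConst → PTerm → List PTerm → PTerm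

mutual
  embed : PTerm → Term
  embed (pnum n)      = num n
  embed (pconst c)    = const c
  embed pinf          = inf
  embed psup          = sup
  embed (papp f t ts) = app f (embed t) (embeds ts)

  embeds : List PTerm → List Term
  embeds []       = []
  embeds (t ∷ ts) = embed t ∷ embeds ts

record Atom : Set where
  constructor atom
  field
    pred : SymConst
    args : List Term
open Atom public

data SLit : Set where
  pos : Atom → SLit
  neg : Atom → SLit

data Cmp : Set where
  eq neq lt gt le ge : Cmp

data Lit : Set where
  symb : SLit → Lit
  cmp  : Term → Cmp → Term → Lit

data AggName : Set where
  count sum max min : AggName

record AggAtom : Set where
  constructor aggAtom
  field
    name   : AggName
    elems  : List Term
    cond   : List Lit
    rel    : Cmp
    bound  : Term
open AggAtom public

data BodyLit : Set where
  lit  : Lit → BodyLit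
  aggP : AggAtom → BodyLit
  aggN : AggAtom → BodyLit

record Rule : Set where
  constructor _⇐_
  field
    head : List Atom
    body : List BodyLit
open Rule public

Program : Set
Program = List Rule

floorDiv : ℤ → ℤ → Maybe ℤ
floorDiv m (+ 0)      = nothing
floorDiv m (+ suc k)  = just (m ℤ./ℕ suc k)
floorDiv m -[1+ k ]   = just ((ℤ.- m) ℤ./ℕ suc k)

applyOp : ArOp → ℤ → ℤ → Maybe ℤ
applyOp plus   m n = just (m ℤ.+ n)
applyOp minus  m n = just (m ℤ.- n)
applyOp times  m n = just (m ℤ.* n)
applyOp divide m n = floorDiv m n

mutual
  -- val t = just v  iff  t is well-formed with value v
  val : Term → Maybe PTerm
  val (num n)   = just (pnum n)
  val (const c) = just (pconst c)
  val (var _)   = nothing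
  val inf       = just pinf
  val sup       = just psup
  val (app f t ts) with val t | vals ts
  ... | just v | just vs = just (papp f v vs)
  ... | _      | _       = nothing
  val (arith o t u) with val t | val u
  ... | just (pnum m) | just (pnum n) = Maybe.map pnum (applyOp o m n)
  ... | _             | _             = nothing

  vals : List Term → Maybe (List PTerm)
  vals []       = just []
  vals (t ∷ ts) with val t | vals ts
  ... | just v | just vs = just (v ∷ vs)
  ... | _      | _       = nothing

GAtom : Set
GAtom = SymConst × List PTerm

evalAtom : Atom → Maybe GAtom
evalAtom (atom p ts) = Maybe.map (p ,_) (vals ts)

Defined : {A : Set} → Maybe A → Set
Defined {A} m = Σ A λ a → m ≡ just a

mutual
  varsT : Term → List Variable
  varsT (num _)       = []
  varsT (const _)     = []
  varsT (var x)       = x ∷ []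
  varsT inf           = []
  varsT sup           = []
  varsT (app f t ts)  = varsT t ++ varsTs ts
  varsT (arith o t u) = varsT t ++ varsT u

  varsTs : List Term → List Variable
  varsTs []       = []
  varsTs (t ∷ ts) = varsT t ++ varsTs ts

varsAtom : Atom → List Variable
varsAtom (atom p ts) = varsTs ts

varsLit : Lit → List Variable
varsLit (symb (pos A)) = varsAtom A
varsLit (symb (neg A)) = varsAtom A
varsLit (cmp t c u)    = varsT t ++ varsT u

globalBL : BodyLit → List Variable
globalBL (lit L)  = varsLit L
globalBL (aggP E) = varsT (bound E)
globalBL (aggN E) = varsT (bound E)

globalVars : Rule → List Variable
globalVars R = deduplicate ℕ._≟_ (concatMap varsAtom (head R) ++ concatMap globalBL (body R))

elemVars : AggAtom → List Variable
elemVars E = deduplicate ℕ._≟_ (varsTs (elems E) ++ concatMap varsLit (cond E))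

substVar : (xs : List Variable) → Vec PTerm (length xs) → Variable → Term
substVar []       []       x = var x
substVar (y ∷ ys) (r ∷ rs) x = if x ≡ᵇ y then embed r else substVar ys rs x

module _ (xs : List Variable) (r : Vec PTerm (length xs)) where
  mutual
    substT : Term → Term
    substT (num n)       = num n
    substT (const c)     = const c
    substT (var x)       = substVar xs r x
    substT inf           = inf
    substT sup           = sup
    substT (app f t ts)  = app f (substT t) (substTs ts)
    substT (arith o t u) = arith o (substT t) (substT u)

    substTs : List Term → List Term
    substTs []       = []
    substTs (t ∷ ts) = substT t ∷ substTs ts

  substAtom : Atom → Atom
  substAtom (atom p ts) = atom p (substTs ts)

  substLit : Lit → Lit
  substLit (symb (pos A)) = symb (pos (substAtom A))
  substLit (symb (neg A)) = symb (neg (substAtom A))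
  substLit (cmp t c u)    = cmp (substT t) c (substT u)

  substAgg : AggAtom → AggAtom
  substAgg (aggAtom α ts L c s) = aggAtom α (substTs ts) (List.map substLit L) c (substT s)

  substBL : BodyLit → BodyLit
  substBL (lit L)  = lit (substLit L)
  substBL (aggP E) = aggP (substAgg E)
  substBL (aggN E) = aggN (substAgg E)

data Formula : Set₁ where
  atm : GAtom → Formula
  ⋀   : (I : Set) → (I → Formula) → Formula
  ⋁   : (I : Set) → (I → Formula) → Formula
  _⇒_ : Formula → Formula → Formula

⊤f : Formula
⊤f = ⋀ ⊥ ⊥-elim

⊥f : Formula
⊥f = ⋁ ⊥ ⊥-elim

¬f : Formula → Formula
¬f F = F ⇒ ⊥f

_∧f_ : Formula → Formula → Formula
F ∧f G = ⋀ Bool (λ b → if b then F else G)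

conj : List Formula → Formula
conj fs = ⋀ (Fin (length fs)) (lookup fs)

disj : List Formula → Formula
disj fs = ⋁ (Fin (length fs)) (lookup fs)

Interp : Set
Interp = GAtom → Bool

_⊨_ : Interp → Formula → Set
I ⊨ atm p   = I p ≡ true
I ⊨ ⋀ A f   = (a : A) → I ⊨ f a
I ⊨ ⋁ A f   = Σ A λ a → I ⊨ f a
I ⊨ (F ⇒ G) = I ⊨ F → I ⊨ G

_⊆I_ : Interp → Interp → Set
I ⊆I J = ∀ p → I p ≡ true → J p ≡ true

record FormulaSet : Set₁ where
  constructor fset
  field
    Idx  : Set
    elem : Idx → Formula
open FormulaSet public

_⊨s_ : Interp → FormulaSet → Set
I ⊨s H = ∀ i → I ⊨ elem H i

MinimalModel : FormulaSet → Interp → Set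
MinimalModel H I = I ⊨s H × (∀ J → J ⊆I I → J ⊨s H → I ⊆I J)

record RuleFormula : Set₁ where
  constructor _⟹_
  field
    antecedent : Formula
    consequent : List GAtom
open RuleFormula public

toFormula : RuleFormula → Formula
toFormula (G ⟹ hs) = G ⇒ disj (List.map atm hs)

record RuleFormulaSet : Set₁ where
  constructor rfset
  field
    RIdx  : Set
    relem : RIdx → RuleFormula
open RuleFormulaSet public

asFormulaSet : RuleFormulaSet → FormulaSet
asFormulaSet H = fset (RIdx H) (λ i → toFormula (relem H i))

FLPReduct : RuleFormulaSet → Interp → FormulaSet
FLPReduct H I = fset (Σ (RIdx H) λ i → I ⊨ antecedent (relem H i))
                     (λ i → toFormula (relem H (proj₁ i)))

FLPStableF : RuleFormulaSet → Interp → Set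
FLPStableF H I = MinimalModel (FLPReduct H I) I

-- FT(G → H, I) is ⊥ if I ⊭ G → H and FT(G,I) → FT(H,I) otherwise; this is
-- rendered as the disjunction, indexed by the proofs of  I ⊨ G → H,  of the
-- single formula FT(G,I) → FT(H,I) (empty disjunction = ⊥).
FT : Formula → Interp → Formula
FT (atm p)   I = if I p then atm p else ⊥f
FT (⋀ A f)   I = ⋀ A (λ a → FT (f a) I)
FT (⋁ A f)   I = ⋁ A (λ a → FT (f a) I)
FT (F ⇒ G)   I = ⋁ (I ⊨ (F ⇒ G)) (λ _ → FT F I ⇒ FT G I)

FTReduct : FormulaSet → Interp → FormulaSet
FTReduct H I = fset (Idx H) (λ i → FT (elem H i) I)

FTStableF : FormulaSet → Interp → Set
FTStableF H I = MinimalModel (FTReduct H I) I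

record TermOrder : Set₁ where
  field
    _≼_          : PTerm → PTerm → Set
    isTotalOrder : IsTotalOrder _≡_ _≼_
    inf-least    : ∀ t → pinf ≼ t
    sup-greatest : ∀ t → t ≼ psup
    num-order    : ∀ m n → (pnum m ≼ pnum n) ⇔ (m ℤ.≤ n)
open TermOrder public

Tuple : Set
Tuple = List PTerm

TupleSet : Set₁
TupleSet = Tuple → Set

Enumerates : TupleSet → List Tuple → Set
Enumerates T l = Unique l × (∀ x → T x ⇔ x ∈ l)

Finite : TupleSet → Set
Finite T = Σ (List Tuple) λ l → ∀ x → T x → x ∈ l

weight : Tuple → ℤ
weight (pnum n ∷ _) = n
weight _            = + 0

firstElem : Tuple → Maybe PTerm
firstElem []      = nothing
firstElem (t ∷ _) = just t

sumℤ : List ℤ → ℤ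
sumℤ = List.foldr ℤ._+_ (+ 0)

module _ (O : TermOrder) where

  Holds : Cmp → PTerm → PTerm → Set
  Holds eq  v w = v ≡ w
  Holds neq v w = v ≢ w
  Holds lt  v w = _≼_ O v w × v ≢ w
  Holds gt  v w = _≼_ O w v × v ≢ w
  Holds le  v w = _≼_ O v w
  Holds ge  v w = _≼_ O w v

  LeastFirst : TupleSet → PTerm → Set
  LeastFirst T v = (Σ Tuple λ x → T x × firstElem x ≡ just v)
                 × (∀ x w → T x → firstElem x ≡ just w → _≼_ O v w)

  GreatestFirst : TupleSet → PTerm → Set
  GreatestFirst T v = (Σ Tuple λ x → T x × firstElem x ≡ just v)
                    × (∀ x w → T x → firstElem x ≡ just w → _≼_ O w v)

  NonZeroW : TupleSet → TupleSet
  NonZeroW T x = T x × weight x ≢ + 0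

  Empty : TupleSet → Set
  Empty T = ∀ x → ¬ T x

  AggVal : AggName → TupleSet → PTerm → Set
  AggVal count T v =
      (Σ (List Tuple) λ l → Enumerates T l × v ≡ pnum (+ length l))
    ⊎ (¬ Finite T × v ≡ psup)
  AggVal sum T v =
      (Σ (List Tuple) λ l → Enumerates (NonZeroW T) l × v ≡ pnum (sumℤ (List.map weight l)))
    ⊎ (¬ Finite (NonZeroW T) × v ≡ psup)
  AggVal min T v =
      (Empty T × v ≡ psup)
    ⊎ ((Finite T × ¬ Empty T × LeastFirst T v)
    ⊎ (¬ Finite T × v ≡ pinf))
  AggVal max T v =
      (Empty T × v ≡ pinf)
    ⊎ ((Finite T × ¬ Empty T × GreatestFirst T v)
    ⊎ (¬ Finite T × v ≡ psup))

  LitOK : Lit → Set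
  LitOK (symb (pos A)) = Defined (evalAtom A)
  LitOK (symb (neg A)) = Defined (evalAtom A)
  LitOK (cmp t c u)    = Σ PTerm λ v → Σ PTerm λ w →
                           val t ≡ just v × val u ≡ just w × Holds c v w

  BodyLitOK : BodyLit → Set
  BodyLitOK (lit L)  = LitOK L
  BodyLitOK (aggP E) = Defined (val (bound E))
  BodyLitOK (aggN E) = Defined (val (bound E))

  Justifies : AggAtom → TupleSet → Set
  Justifies E T = Σ PTerm λ v → Σ PTerm λ w →
                    AggVal (name E) T v × val (bound E) ≡ just w × Holds (rel E) v w

atomF : Atom → Formula
atomF A with evalAtom A
... | just a  = atm a
... | nothing = ⊥f      -- never used: only applied to well-formed atoms

slitF : SLit → Formula
slitF (pos A) = atomF A
slitF (neg A) = ¬f (atomF A)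

litFs : List Lit → List Formula
litFs []             = []
litFs (symb l ∷ Ls)  = slitF l ∷ litFs Ls
litFs (cmp _ _ _ ∷ Ls) = litFs Ls

litsF : List Lit → Formula
litsF Ls = conj (litFs Ls)

module _ (O : TermOrder) (E : AggAtom) where
  private
    xs : List Variable
    xs = elemVars E

  Inst : Set
  Inst = Vec PTerm (length xs)

  tupleOf : Inst → Maybe Tuple
  tupleOf r = vals (substTs xs r (elems E))

  condOf : Inst → List Lit
  condOf r = List.map (substLit xs r) (cond E)

  InA : Inst → Set
  InA r = Defined (tupleOf r) × All (LitOK O) (condOf r)

  SubsetA : Set
  SubsetA = Σ (Inst → Bool) λ Δ → ∀ r → Δ r ≡ true → InA r

  In : SubsetA → Inst → Set
  In (Δ , _) r = Δ r ≡ true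

  OutOf : SubsetA → Inst → Set
  OutOf (Δ , _) r = InA r × Δ r ≡ false

  valΔ : SubsetA → TupleSet
  valΔ Δ x = Σ Inst λ r → In Δ r × tupleOf r ≡ just x

  JustifiesΔ : SubsetA → Set
  JustifiesΔ Δ = Justifies O E (valΔ Δ)

  τ₁Agg : Formula
  τ₁Agg = ⋁ (Σ SubsetA JustifiesΔ) λ p →
            ⋀ (Σ Inst (In (proj₁ p))) (λ q → litsF (condOf (proj₁ q)))
         ∧f ⋀ (Σ Inst (OutOf (proj₁ p))) (λ q → ¬f (litsF (condOf (proj₁ q))))

  τAgg : Formula
  τAgg = ⋀ (Σ SubsetA λ Δ → ¬ JustifiesΔ Δ) λ p →
            ⋀ (Σ Inst (In (proj₁ p))) (λ q → litsF (condOf (proj₁ q)))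
         ⇒ ⋁ (Σ Inst (OutOf (proj₁ p))) (λ q → litsF (condOf (proj₁ q)))

bodyFs : (AggAtom → Formula) → List BodyLit → List Formula
bodyFs τa []                      = []
bodyFs τa (lit (symb l) ∷ Bs)     = slitF l ∷ bodyFs τa Bs
bodyFs τa (lit (cmp _ _ _) ∷ Bs)  = bodyFs τa Bs
bodyFs τa (aggP E ∷ Bs)           = τa E ∷ bodyFs τa Bs
bodyFs τa (aggN E ∷ Bs)           = ¬f (τa E) ∷ bodyFs τa Bs

module _ (O : TermOrder) (τa : AggAtom → Formula) where

  RuleInst : Rule → Set
  RuleInst R = Σ (Vec PTerm (length (globalVars R))) λ r →
                 All (BodyLitOK O) (List.map (substBL (globalVars R) r) (body R))
               × All (λ A → Defined (evalAtom A)) (List.map (substAtom (globalVars R) r) (head R))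

  ruleInstF : (R : Rule) → RuleInst R → RuleFormula
  ruleInstF R (r , _) =
    conj (bodyFs τa (List.map (substBL (globalVars R) r) (body R)))
    ⟹ mapMaybe evalAtom (List.map (substAtom (globalVars R) r) (head R))

  translate : Program → RuleFormulaSet
  translate Π = rfset (Σ (Σ Rule (_∈ Π)) λ R → RuleInst (proj₁ R))
                      (λ i → ruleInstF (proj₁ (proj₁ i)) (proj₂' i))
    where
      proj₂' : (i : Σ (Σ Rule (_∈ Π)) λ R → RuleInst (proj₁ R)) → RuleInst (proj₁ (proj₁ i))
      proj₂' (_ , x) = x

τ₁Prog : TermOrder → Program → RuleFormulaSet
τ₁Prog O = translate O (τ₁Agg O)

τProg : TermOrder → Program → FormulaSet
τProg O Π = asFormulaSet (translate O (τAgg O) Π)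

FLPStable : TermOrder → Program → Interp → Set
FLPStable O Π I = FLPStableF (τ₁Prog O Π) I

FTStable : TermOrder → Program → Interp → Set
FTStable O Π I = FTStableF (τProg O Π) I

PredSym : Set
PredSym = SymConst × ℕ

predSym : Atom → PredSym
predSym (atom p ts) = p , length ts

atomsLit : Lit → List Atom
atomsLit (symb (pos A)) = A ∷ []
atomsLit (symb (neg A)) = A ∷ []
atomsLit (cmp _ _ _)    = []

atomsBL : BodyLit → List Atom
atomsBL (lit L)  = atomsLit L
atomsBL (aggP E) = concatMap atomsLit (cond E)
atomsBL (aggN E) = concatMap atomsLit (cond E)

Edge : Program → PredSym → PredSym → Set
Edge Π P Q = Σ Rule λ R → R ∈ Π
           × (Σ Atom λ A → A ∈ head R × predSym A ≡ P)
           × (Σ Atom λ B → B ∈ concatMap atomsBL (body R) × predSym B ≡ Q)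

Path : Program → PredSym → PredSym → Set
Path Π = Star (Edge Π)

IsAggLit : BodyLit → Set
IsAggLit (lit _)  = ⊥
IsAggLit (aggP _) = ⊤
IsAggLit (aggN _) = ⊤

RecursiveOcc : Program → Rule → BodyLit → Set
RecursiveOcc Π R L = Σ Atom λ A → A ∈ atomsBL L ×
                     Σ Atom λ H → H ∈ head R × Path Π (predSym A) (predSym H)

IsPosLit : Lit → Set
IsPosLit (symb (pos _)) = ⊤
IsPosLit (symb (neg _)) = ⊥
IsPosLit (cmp _ _ _)    = ⊤

PositiveAgg : BodyLit → Set
PositiveAgg (lit _)  = ⊥
PositiveAgg (aggP E) = All IsPosLit (cond E)
PositiveAgg (aggN _) = ⊥

RecursiveAggsPositive : Program → Set
RecursiveAggsPositive Π = ∀ R → R ∈ Π → ∀ L → L ∈ body R →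
                          IsAggLit L → RecursiveOcc Π R L → PositiveAgg L

-- Classically τ₁ E and τ E are equivalent, so τ₁Π and τΠ have the same models and I is a
-- model of its FLP reduct iff it is a model of its FT reduct.  For J ⊆ I, J satisfies FT(F, I)
-- iff both I and J satisfy F, provided F is positive, the negation of a positive formula, a
-- conjunction of implications between positive formulas (τ E for a positive aggregate E), or
-- has only atoms on which J and I agree; on rule bodies made of such formulas the two reducts
-- impose the same condition on J.  Given a proper submodel J of one reduct, pick an atom a of
-- I ∖ J whose predicate symbol q strictly reaches no predicate symbol of another atom of I ∖ J
-- (possible since the dependency graph is finite), and let J′ follow J on the predicate symbols
-- reachable from q and I elsewhere.  A rule instance can only be violated by J′ if one of its
-- head predicate symbols is reachable from q; then J′ agrees with J on its body, and each
-- non-positive aggregate in it is non-recursive, so its atoms lie strictly below q, where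
-- J, J′ and I agree.  Hence J′ is a proper submodel of the other reduct.

module Submission where

open import Defs
open import Level using (0ℓ)
open import Axiom.ExcludedMiddle using (ExcludedMiddle)
open import Function.Base using (_∘_)
open import Function.Bundles using (_⇔_; mk⇔; Equivalence)
open import Data.Bool using (true; false; if_then_else_)
open import Data.Bool.Properties using (⇔→≡)
open import Data.Empty using (⊥; ⊥-elim)
open import Data.Unit using (⊤; tt)
open import Data.Product using (Σ; _×_; _,_; proj₁; proj₂)
open import Data.Sum using (_⊎_; inj₁; inj₂)
open import Data.Fin using (Fin; zero; suc)
open import Data.Nat using (ℕ; suc; _≤_; _<_; z≤n; s≤s)
open import Data.Nat.Properties using (m≤n⇒m≤1+n)
open import Data.Nat.Induction using (<-wellFounded)
open import Induction.WellFounded using (Acc; acc)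
open import Data.Maybe using (just; nothing)
open import Data.Vec using (Vec)
open import Data.List as List using (List; []; _∷_; _++_; length; lookup; concatMap; mapMaybe)
open import Data.List.Properties using (map-concatMap)
open import Data.List.Relation.Unary.All as All using (All; []; _∷_)
import Data.List.Relation.Unary.All.Properties as All
open import Data.List.Relation.Unary.Any as Any using (Any; here; there)
open import Data.List.Relation.Binary.Pointwise as Pointwise using (Pointwise; []; _∷_)
open import Data.List.Membership.Propositional using (_∈_; find; lose)
open import Data.List.Membership.Propositional.Properties
  using (∈-lookup; ∈-++⁺ˡ; ∈-++⁺ʳ; ∈-map⁺; ∈-map⁻; ∈-concatMap⁺)
open import Relation.Nullary using (¬_; Dec; yes; no)
open import Relation.Nullary.Decidable using (isYes)
open import Relation.Unary using (_⊆_; _≐_)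
open import Relation.Binary.Construct.Closure.ReflexiveTransitive using (ε; _◅_; _◅◅_)
open import Relation.Binary.PropositionalEquality using (_≡_; refl; sym; trans; cong; cong₂; subst)

false≢true : false ≡ true → ⊥
false≢true ()

isYes≡true⇒ : ∀ {P : Set} (d : Dec P) → isYes d ≡ true → P
isYes≡true⇒ (yes p) _ = p

isYes≡false⇒¬ : ∀ {P : Set} (d : Dec P) → isYes d ≡ false → ¬ P
isYes≡false⇒¬ (no ¬p) _ = ¬p

open Equivalence using (to; from)

⊆I-refl : ∀ {I} → I ⊆I I
⊆I-refl _ Ig = Ig

-- Positive formulas and the FT reduct

Positive : Formula → Set
Positive (atm _)  = ⊤
Positive (⋀ _ f)  = ∀ x → Positive (f x)
Positive (⋁ _ f)  = ∀ x → Positive (f x)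
Positive (_ ⇒ _)  = ⊥

AllAtoms : (GAtom → Set) → Formula → Set
AllAtoms P (atm g) = P g
AllAtoms P (⋀ _ f) = ∀ x → AllAtoms P (f x)
AllAtoms P (⋁ _ f) = ∀ x → AllAtoms P (f x)
AllAtoms P (F ⇒ G) = AllAtoms P F × AllAtoms P G

AgreeOn : (GAtom → Set) → Interp → Interp → Set
AgreeOn P I J = ∀ g → P g → I g ≡ J g

AllAtoms-mono : ∀ {P Q} → P ⊆ Q → ∀ F → AllAtoms P F → AllAtoms Q F
AllAtoms-mono P⊆Q (atm g) p       = P⊆Q p
AllAtoms-mono P⊆Q (⋀ _ f) p       = λ x → AllAtoms-mono P⊆Q (f x) (p x)
AllAtoms-mono P⊆Q (⋁ _ f) p       = λ x → AllAtoms-mono P⊆Q (f x) (p x)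
AllAtoms-mono P⊆Q (F ⇒ G) (p , q) = AllAtoms-mono P⊆Q F p , AllAtoms-mono P⊆Q G q

⊨-agreeOn : ∀ {P I J} F → AllAtoms P F → AgreeOn P I J → I ⊨ F ⇔ J ⊨ F
⊨-agreeOn (atm g) p e = mk⇔ (trans (sym (e g p))) (trans (e g p))
⊨-agreeOn (⋀ _ f) p e = mk⇔ (λ h x → to (⊨-agreeOn (f x) (p x) e) (h x))
                            (λ h x → from (⊨-agreeOn (f x) (p x) e) (h x))
⊨-agreeOn (⋁ _ f) p e = mk⇔ (λ (x , h) → x , to (⊨-agreeOn (f x) (p x) e) h)
                            (λ (x , h) → x , from (⊨-agreeOn (f x) (p x) e) h)
⊨-agreeOn (F ⇒ G) (p , q) e =
  mk⇔ (λ h → to (⊨-agreeOn G q e) ∘ h ∘ from (⊨-agreeOn F p e))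
      (λ h → from (⊨-agreeOn G q e) ∘ h ∘ to (⊨-agreeOn F p e))

FT-atoms : ∀ {P} I F → AllAtoms P F → AllAtoms P (FT F I)
FT-atoms I (atm g) p with I g
... | true  = p
... | false = λ ()
FT-atoms I (⋀ _ f) p       = λ x → FT-atoms I (f x) (p x)
FT-atoms I (⋁ _ f) p       = λ x → FT-atoms I (f x) (p x)
FT-atoms I (F ⇒ G) (p , q) = λ _ → FT-atoms I F p , FT-atoms I G q

FT-sound : ∀ {J I} F → J ⊆I I → J ⊨ FT F I → I ⊨ F
FT-sound {I = I} (atm g) J⊆I h with I g
... | true  = refl
... | false = ⊥-elim (proj₁ h)
FT-sound (⋀ _ f) J⊆I h       = λ x → FT-sound (f x) J⊆I (h x)
FT-sound (⋁ _ f) J⊆I (x , h) = x , FT-sound (f x) J⊆I h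
FT-sound (F ⇒ G) J⊆I (h , _) = h

FT-self : ∀ {I} F → I ⊨ F → I ⊨ FT F I
FT-self {I} (atm g) h with I g in e
... | true  = e
... | false = ⊥-elim (false≢true h)
FT-self (⋀ _ f) h       = λ x → FT-self (f x) (h x)
FT-self (⋁ _ f) (x , h) = x , FT-self (f x) h
FT-self (F ⇒ G) h       = h , λ h′ → FT-self G (h (FT-sound F ⊆I-refl h′))

FT-positive : ∀ {J I} F → Positive F → J ⊆I I → J ⊨ FT F I ⇔ J ⊨ F
FT-positive {I = I} (atm g) _ J⊆I with I g in e
... | true  = mk⇔ (λ h → h) (λ h → h)
... | false = mk⇔ (λ h → ⊥-elim (proj₁ h)) (λ h → ⊥-elim (false≢true (trans (sym e) (J⊆I g h))))
FT-positive (⋀ _ f) pF J⊆I = mk⇔ (λ h x → to (FT-positive (f x) (pF x) J⊆I) (h x))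
                                  (λ h x → from (FT-positive (f x) (pF x) J⊆I) (h x))
FT-positive (⋁ _ f) pF J⊆I = mk⇔ (λ (x , h) → x , to (FT-positive (f x) (pF x) J⊆I) h)
                                  (λ (x , h) → x , from (FT-positive (f x) (pF x) J⊆I) h)
FT-positive (_ ⇒ _) () _

positive-mono : ∀ {J I} F → Positive F → J ⊆I I → J ⊨ F → I ⊨ F
positive-mono F pF J⊆I = FT-sound F J⊆I ∘ from (FT-positive F pF J⊆I)

FTExact : Interp → Interp → Formula → Set
FTExact J I F = J ⊨ FT F I ⇔ (I ⊨ F × J ⊨ F)

positive-FTExact : ∀ {J I} F → Positive F → J ⊆I I → FTExact J I F
positive-FTExact F pF J⊆I =
  mk⇔ (λ h → FT-sound F J⊆I h , to (FT-positive F pF J⊆I) h)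
      (λ (_ , h) → from (FT-positive F pF J⊆I) h)

¬positive-FTExact : ∀ {J I} F → Positive F → J ⊆I I → FTExact J I (¬f F)
¬positive-FTExact F pF J⊆I =
  mk⇔ (λ (h , _) → h , λ j → ⊥-elim (proj₁ (h (positive-mono F pF J⊆I j))))
      (λ (h , _) → h , λ j → ⊥-elim (proj₁ (h (FT-sound F J⊆I j))))

⇒positive-FTExact : ∀ {J I} G H → Positive G → Positive H → J ⊆I I → FTExact J I (G ⇒ H)
⇒positive-FTExact G H pG pH J⊆I =
  mk⇔ (λ (h , k) → h , to (FT-positive H pH J⊆I) ∘ k ∘ from (FT-positive G pG J⊆I))
      (λ (h , k) → h , from (FT-positive H pH J⊆I) ∘ k ∘ to (FT-positive G pG J⊆I))

⋀-FTExact : ∀ {J I X} (f : X → Formula) → (∀ x → FTExact J I (f x)) → FTExact J I (⋀ X f)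
⋀-FTExact f exact =
  mk⇔ (λ h → (λ x → proj₁ (to (exact x) (h x))) , (λ x → proj₂ (to (exact x) (h x))))
      (λ (h , k) x → from (exact x) (h x , k x))

agreeOn-FTExact : ∀ {P J I} F → AllAtoms P F → AgreeOn P J I → FTExact J I F
agreeOn-FTExact {I = I} F atoms J≐I =
  mk⇔ (λ h → let hI = FT-sound F ⊆I-refl (to (⊨-agreeOn (FT F I) (FT-atoms I F atoms) J≐I) h)
             in hI , from (⊨-agreeOn F atoms J≐I) hI)
      (λ (hI , _) → from (⊨-agreeOn (FT F I) (FT-atoms I F atoms) J≐I) (FT-self F hI))

lookup-All : ∀ {Q : Formula → Set} {fs} → All Q fs → (i : Fin (length fs)) → Q (lookup fs i)
lookup-All qs i = All.lookup qs (∈-lookup i)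

-- Aggregates and their two translations

private variable
  T T′ : TupleSet

Enumerates-≐ : ∀ {l} → T ≐ T′ → Enumerates T l → Enumerates T′ l
Enumerates-≐ (T⊆T′ , T′⊆T) (unique , enum) =
  unique , λ x → mk⇔ (to (enum x) ∘ T′⊆T) (T⊆T′ ∘ from (enum x))

Finite-⊆ : T ⊆ T′ → Finite T′ → Finite T
Finite-⊆ T⊆T′ (l , complete) = l , λ x → complete x ∘ T⊆T′

module _ (O : TermOrder) where

  Empty-⊆ : T ⊆ T′ → Empty O T′ → Empty O T
  Empty-⊆ T⊆T′ empty x = empty x ∘ T⊆T′

  NonZeroW-≐ : T ≐ T′ → NonZeroW O T ≐ NonZeroW O T′
  NonZeroW-≐ (T⊆T′ , T′⊆T) = (λ (t , w) → T⊆T′ t , w) , (λ (t , w) → T′⊆T t , w)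

  LeastFirst-≐ : ∀ {v} → T ≐ T′ → LeastFirst O T v → LeastFirst O T′ v
  LeastFirst-≐ (T⊆T′ , T′⊆T) ((x , t , first) , least) =
    (x , T⊆T′ t , first) , λ y w t′ → least y w (T′⊆T t′)

  GreatestFirst-≐ : ∀ {v} → T ≐ T′ → GreatestFirst O T v → GreatestFirst O T′ v
  GreatestFirst-≐ (T⊆T′ , T′⊆T) ((x , t , first) , greatest) =
    (x , T⊆T′ t , first) , λ y w t′ → greatest y w (T′⊆T t′)

  AggVal-≐ : ∀ α {v} → T ≐ T′ → AggVal O α T v → AggVal O α T′ v
  AggVal-≐ count T≐T′ (inj₁ (l , enum , v≡)) = inj₁ (l , Enumerates-≐ T≐T′ enum , v≡)
  AggVal-≐ count T≐T′ (inj₂ (infinite , v≡)) = inj₂ (infinite ∘ Finite-⊆ (proj₁ T≐T′) , v≡)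
  AggVal-≐ sum T≐T′ (inj₁ (l , enum , v≡)) = inj₁ (l , Enumerates-≐ (NonZeroW-≐ T≐T′) enum , v≡)
  AggVal-≐ sum T≐T′ (inj₂ (infinite , v≡)) =
    inj₂ (infinite ∘ Finite-⊆ (proj₁ (NonZeroW-≐ T≐T′)) , v≡)
  AggVal-≐ min (T⊆T′ , T′⊆T) (inj₁ (empty , v≡)) = inj₁ (Empty-⊆ T′⊆T empty , v≡)
  AggVal-≐ min T≐T′@(T⊆T′ , T′⊆T) (inj₂ (inj₁ (finite , nonempty , least))) =
    inj₂ (inj₁ (Finite-⊆ T′⊆T finite , nonempty ∘ Empty-⊆ T⊆T′ , LeastFirst-≐ T≐T′ least))
  AggVal-≐ min (T⊆T′ , _) (inj₂ (inj₂ (infinite , v≡))) =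
    inj₂ (inj₂ (infinite ∘ Finite-⊆ T⊆T′ , v≡))
  AggVal-≐ max (T⊆T′ , T′⊆T) (inj₁ (empty , v≡)) = inj₁ (Empty-⊆ T′⊆T empty , v≡)
  AggVal-≐ max T≐T′@(T⊆T′ , T′⊆T) (inj₂ (inj₁ (finite , nonempty , greatest))) =
    inj₂ (inj₁ (Finite-⊆ T′⊆T finite , nonempty ∘ Empty-⊆ T⊆T′ , GreatestFirst-≐ T≐T′ greatest))
  AggVal-≐ max (T⊆T′ , _) (inj₂ (inj₂ (infinite , v≡))) =
    inj₂ (inj₂ (infinite ∘ Finite-⊆ T⊆T′ , v≡))

  Justifies-≐ : ∀ E → T ≐ T′ → Justifies O E T → Justifies O E T′
  Justifies-≐ E T≐T′ (v , w , agg , bound≡ , holds) = v , w , AggVal-≐ (name E) T≐T′ agg , bound≡ , holds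

module _ (O : TermOrder) (E : AggAtom) where

  private
    condF : Inst O E → Formula
    condF r = litsF (condOf O E r)

  valΔ-≐ : ∀ {Δ Δ′} → In O E Δ ≐ In O E Δ′ → valΔ O E Δ ≐ valΔ O E Δ′
  valΔ-≐ (Δ⊆Δ′ , Δ′⊆Δ) = (λ (r , r∈ , t) → r , Δ⊆Δ′ r∈ , t)
                        , (λ (r , r∈ , t) → r , Δ′⊆Δ r∈ , t)

  notOutOf⇒In : (Δ : SubsetA O E) → ∀ r → InA O E r → ¬ OutOf O E Δ r → In O E Δ r
  notOutOf⇒In (Δ , _) r r∈A notOut with Δ r
  ... | true  = refl
  ... | false = ⊥-elim (notOut (r∈A , refl))

  -- A model of τ₁ E singles out the justifying Δ₀ of instances whose condition it satisfies;
  -- a non-justifying Δ must therefore differ from Δ₀ by a satisfied instance outside Δ.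
  τ₁Agg⇒τAgg : ExcludedMiddle 0ℓ → ∀ {J} → J ⊨ τ₁Agg O E → J ⊨ τAgg O E
  τ₁Agg⇒τAgg em {J} ((Δ₀ , justified) , sat) (Δ , unjustified) satΔ
    with em {Σ (Σ (Inst O E) (OutOf O E Δ)) λ q → J ⊨ condF (proj₁ q)}
  ... | yes witness = witness
  ... | no none = ⊥-elim (unjustified (Justifies-≐ O E (valΔ-≐ {Δ₀} {Δ} (Δ₀⊆Δ , Δ⊆Δ₀)) justified))
    where
      Δ₀⊆Δ : In O E Δ₀ ⊆ In O E Δ
      Δ₀⊆Δ {r} r∈ = notOutOf⇒In Δ r (proj₂ Δ₀ r r∈) (λ out → none ((r , out) , sat true (r , r∈)))
      Δ⊆Δ₀ : In O E Δ ⊆ In O E Δ₀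
      Δ⊆Δ₀ {r} r∈ =
        notOutOf⇒In Δ₀ r (proj₂ Δ r r∈) λ out → proj₁ (sat false (r , out) (satΔ (r , r∈)))

  module _ (em : ExcludedMiddle 0ℓ) (J : Interp) where

    private
      Satisfied : Inst O E → Set
      Satisfied r = InA O E r × J ⊨ condF r

    ΔJ : SubsetA O E
    ΔJ = (λ r → isYes (em {Satisfied r})) , λ r → proj₁ ∘ isYes≡true⇒ em

    τAgg⇒τ₁Agg : J ⊨ τAgg O E → J ⊨ τ₁Agg O E
    τAgg⇒τ₁Agg sat with em {JustifiesΔ O E ΔJ}
    ... | yes justified = (ΔJ , justified) , λ where
      true  (r , r∈) → proj₂ (isYes≡true⇒ em r∈)
      false (r , r∈A , r∉) satisfied → ⊥-elim (isYes≡false⇒¬ em r∉ (r∈A , satisfied))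
    ... | no unjustified =
      let (r , r∈A , r∉) , satisfied = sat (ΔJ , unjustified) (λ (r , r∈) → proj₂ (isYes≡true⇒ em r∈))
      in ⊥-elim (isYes≡false⇒¬ em r∉ (r∈A , satisfied))

  τ₁Agg⇔τAgg : ExcludedMiddle 0ℓ → ∀ J → J ⊨ τ₁Agg O E ⇔ J ⊨ τAgg O E
  τ₁Agg⇔τAgg em J = mk⇔ (τ₁Agg⇒τAgg em) (τAgg⇒τ₁Agg em J)

gpred : GAtom → PredSym
gpred (p , vs) = p , length vs

predSyms : List Atom → List PredSym
predSyms = List.map predSym

AtomsOver : List PredSym → Formula → Set
AtomsOver ps = AllAtoms (λ g → gpred g ∈ ps)

AtomsOver-++⁺ˡ : ∀ {ps} qs F → AtomsOver ps F → AtomsOver (ps ++ qs) F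
AtomsOver-++⁺ˡ qs = AllAtoms-mono ∈-++⁺ˡ

All-AtomsOver-++⁺ʳ : ∀ ps {qs fs} → All (AtomsOver qs) fs → All (AtomsOver (ps ++ qs)) fs
All-AtomsOver-++⁺ʳ ps = All.map (λ {F} → AllAtoms-mono (∈-++⁺ʳ ps) F)

litPredSyms : List Lit → List PredSym
litPredSyms Ls = predSyms (concatMap atomsLit Ls)

vals-length : ∀ ts {vs} → vals ts ≡ just vs → length vs ≡ length ts
vals-length [] refl = refl
vals-length (t ∷ ts) e with val t | vals ts in vals≡
vals-length (t ∷ ts) refl | just v | just vs = cong suc (vals-length ts vals≡)

evalAtom-predSym : ∀ A {g} → evalAtom A ≡ just g → gpred g ≡ predSym A
evalAtom-predSym (atom p ts) e with vals ts in vals≡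
evalAtom-predSym (atom p ts) refl | just vs = cong (p ,_) (vals-length ts vals≡)

substTs-length : ∀ xs r ts → length (substTs xs r ts) ≡ length ts
substTs-length xs r []       = refl
substTs-length xs r (t ∷ ts) = cong suc (substTs-length xs r ts)

substAtom-predSym : ∀ xs r A → predSym (substAtom xs r A) ≡ predSym A
substAtom-predSym xs r (atom p ts) = cong (p ,_) (substTs-length xs r ts)

litPredSyms-subst : ∀ xs r Ls → litPredSyms (List.map (substLit xs r) Ls) ≡ litPredSyms Ls
litPredSyms-subst xs r []                  = refl
litPredSyms-subst xs r (symb (pos A) ∷ Ls) = cong₂ _∷_ (substAtom-predSym xs r A) (litPredSyms-subst xs r Ls)
litPredSyms-subst xs r (symb (neg A) ∷ Ls) = cong₂ _∷_ (substAtom-predSym xs r A) (litPredSyms-subst xs r Ls)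
litPredSyms-subst xs r (cmp _ _ _ ∷ Ls)    = litPredSyms-subst xs r Ls

atomF-positive : ∀ A → Positive (atomF A)
atomF-positive A with evalAtom A
... | just _  = tt
... | nothing = λ ()

atomF-atoms : ∀ A → AllAtoms (λ g → gpred g ≡ predSym A) (atomF A)
atomF-atoms A with evalAtom A in e
... | just _  = evalAtom-predSym A e
... | nothing = λ ()

litFs-atoms : ∀ Ls → All (AtomsOver (litPredSyms Ls)) (litFs Ls)
litFs-atoms []                  = []
litFs-atoms (symb (pos A) ∷ Ls) =
  AllAtoms-mono here (atomF A) (atomF-atoms A) ∷ All.map (λ {F} → AllAtoms-mono there F) (litFs-atoms Ls)
litFs-atoms (symb (neg A) ∷ Ls) =
  (AllAtoms-mono here (atomF A) (atomF-atoms A) , λ ()) ∷ All.map (λ {F} → AllAtoms-mono there F) (litFs-atoms Ls)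
litFs-atoms (cmp _ _ _ ∷ Ls)    = litFs-atoms Ls

τAgg-atoms : ∀ O E → AtomsOver (litPredSyms (cond E)) (τAgg O E)
τAgg-atoms O E _ = (λ (r , _) → condF-atoms r) , (λ (r , _) → condF-atoms r)
  where
    condF-atoms : ∀ r → AtomsOver (litPredSyms (cond E)) (litsF (condOf O E r))
    condF-atoms r = subst (λ ps → AtomsOver ps (litsF (condOf O E r)))
                          (litPredSyms-subst (elemVars E) r (cond E))
                          (lookup-All (litFs-atoms (condOf O E r)))

substAgg-atoms : ∀ O xs r E → AtomsOver (litPredSyms (cond E)) (τAgg O (substAgg xs r E))
substAgg-atoms O xs r E = subst (λ ps → AtomsOver ps (τAgg O (substAgg xs r E)))
                                (litPredSyms-subst xs r (cond E))
                                (τAgg-atoms O (substAgg xs r E))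

substLit-IsPosLit : ∀ {xs r} L → IsPosLit L → IsPosLit (substLit xs r L)
substLit-IsPosLit (symb (pos _)) _ = tt
substLit-IsPosLit (cmp _ _ _)    _ = tt

litFs-positive : ∀ Ls → All IsPosLit Ls → All Positive (litFs Ls)
litFs-positive []                  []       = []
litFs-positive (symb (pos A) ∷ Ls) (_ ∷ ps) = atomF-positive A ∷ litFs-positive Ls ps
litFs-positive (cmp _ _ _ ∷ Ls)    (_ ∷ ps) = litFs-positive Ls ps

condOf-positive : ∀ O E → All IsPosLit (cond E) → ∀ r → Positive (litsF (condOf O E r))
condOf-positive O E ps r =
  lookup-All (litFs-positive (condOf O E r) (All.map⁺ (All.map (λ {L} → substLit-IsPosLit L) ps)))

bodyPredSyms : List BodyLit → List PredSym
bodyPredSyms = concatMap (predSyms ∘ atomsBL)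

¬f-cong : ∀ {J F G} → J ⊨ F ⇔ J ⊨ G → J ⊨ ¬f F ⇔ J ⊨ ¬f G
¬f-cong F⇔G = mk⇔ (λ ¬F → ¬F ∘ from F⇔G) (λ ¬G → ¬G ∘ to F⇔G)

⊨conj-mono : ∀ {J fs gs} → Pointwise (λ F G → J ⊨ F → J ⊨ G) fs gs → J ⊨ conj fs → J ⊨ conj gs
⊨conj-mono (F⇒G ∷ _)   h zero    = F⇒G (h zero)
⊨conj-mono (_ ∷ fs⇒gs) h (suc i) = ⊨conj-mono fs⇒gs (h ∘ suc) i

⊨conj-cong : ∀ {J fs gs} → Pointwise (λ F G → J ⊨ F ⇔ J ⊨ G) fs gs → J ⊨ conj fs ⇔ J ⊨ conj gs
⊨conj-cong fs⇔gs = mk⇔ (⊨conj-mono (Pointwise.map to fs⇔gs))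
                       (⊨conj-mono (Pointwise.symmetric from fs⇔gs))

bodyFs-cong : ∀ {J τa τb} → (∀ E → J ⊨ τa E ⇔ J ⊨ τb E) →
              ∀ Bs → Pointwise (λ F G → J ⊨ F ⇔ J ⊨ G) (bodyFs τa Bs) (bodyFs τb Bs)
bodyFs-cong τa⇔τb []                    = []
bodyFs-cong τa⇔τb (lit (symb _) ∷ Bs)   = mk⇔ (λ h → h) (λ h → h) ∷ bodyFs-cong τa⇔τb Bs
bodyFs-cong τa⇔τb (lit (cmp _ _ _) ∷ Bs) = bodyFs-cong τa⇔τb Bs
bodyFs-cong τa⇔τb (aggP E ∷ Bs)         = τa⇔τb E ∷ bodyFs-cong τa⇔τb Bs
bodyFs-cong τa⇔τb (aggN E ∷ Bs)         = ¬f-cong (τa⇔τb E) ∷ bodyFs-cong τa⇔τb Bs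

body-τ₁⇔τ : ExcludedMiddle 0ℓ → ∀ O J Bs →
            J ⊨ conj (bodyFs (τ₁Agg O) Bs) ⇔ J ⊨ conj (bodyFs (τAgg O) Bs)
body-τ₁⇔τ em O J Bs = ⊨conj-cong (bodyFs-cong (λ E → τ₁Agg⇔τAgg O E em J) Bs)

ExactLit : Interp → Interp → BodyLit → Set
ExactLit K I B = IsAggLit B → PositiveAgg B ⊎ AgreeOn (λ g → gpred g ∈ predSyms (atomsBL B)) K I

module _ (O : TermOrder) (xs : List Variable) (r : Vec PTerm (length xs)) where

  substAtom-atoms : ∀ {ps} A → AtomsOver (predSym A ∷ ps) (atomF (substAtom xs r A))
  substAtom-atoms A = AllAtoms-mono (λ e → here (trans e (substAtom-predSym xs r A)))
                                    (atomF (substAtom xs r A)) (atomF-atoms (substAtom xs r A))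

  bodyFs-atoms : ∀ Bs → All (AtomsOver (bodyPredSyms Bs)) (bodyFs (τAgg O) (List.map (substBL xs r) Bs))
  bodyFs-atoms [] = []
  bodyFs-atoms (lit (symb (pos A)) ∷ Bs) =
    substAtom-atoms A ∷ All-AtomsOver-++⁺ʳ _ (bodyFs-atoms Bs)
  bodyFs-atoms (lit (symb (neg A)) ∷ Bs) =
    (substAtom-atoms A , λ ()) ∷ All-AtomsOver-++⁺ʳ _ (bodyFs-atoms Bs)
  bodyFs-atoms (lit (cmp _ _ _) ∷ Bs) = bodyFs-atoms Bs
  bodyFs-atoms (aggP E ∷ Bs) =
    AtomsOver-++⁺ˡ _ (τAgg O (substAgg xs r E)) (substAgg-atoms O xs r E)
    ∷ All-AtomsOver-++⁺ʳ _ (bodyFs-atoms Bs)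
  bodyFs-atoms (aggN E ∷ Bs) =
    (AtomsOver-++⁺ˡ _ (τAgg O (substAgg xs r E)) (substAgg-atoms O xs r E) , λ ())
    ∷ All-AtomsOver-++⁺ʳ _ (bodyFs-atoms Bs)

  aggregate-FTExact : ∀ E {K I} → K ⊆I I →
                      PositiveAgg (aggP E) ⊎ AgreeOn (λ g → gpred g ∈ litPredSyms (cond E)) K I →
                      FTExact K I (τAgg O (substAgg xs r E))
  aggregate-FTExact E K⊆I (inj₁ positive) =
    ⋀-FTExact (λ (Δ , _) → satisfiedIn Δ ⇒ satisfiedOutside Δ) λ (Δ , _) →
      ⇒positive-FTExact (satisfiedIn Δ) (satisfiedOutside Δ) (condPositive ∘ proj₁) (condPositive ∘ proj₁) K⊆I
    where
      E′ : AggAtom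
      E′ = substAgg xs r E
      satisfiedIn satisfiedOutside : SubsetA O E′ → Formula
      satisfiedIn Δ      = ⋀ (Σ (Inst O E′) (In O E′ Δ)) (λ (r′ , _) → litsF (condOf O E′ r′))
      satisfiedOutside Δ = ⋁ (Σ (Inst O E′) (OutOf O E′ Δ)) (λ (r′ , _) → litsF (condOf O E′ r′))
      condPositive : ∀ r′ → Positive (litsF (condOf O E′ r′))
      condPositive = condOf-positive O E′ (All.map⁺ (All.map (λ {L} → substLit-IsPosLit L) positive))
  aggregate-FTExact E K⊆I (inj₂ K≐I) = agreeOn-FTExact (τAgg O (substAgg xs r E)) (substAgg-atoms O xs r E) K≐I

  bodyFs-FTExact : ∀ {K I} → K ⊆I I → ∀ Bs → All (ExactLit K I) Bs →
                   All (FTExact K I) (bodyFs (τAgg O) (List.map (substBL xs r) Bs))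
  bodyFs-FTExact K⊆I [] [] = []
  bodyFs-FTExact K⊆I (lit (symb (pos A)) ∷ Bs) (_ ∷ exact) =
    positive-FTExact (atomF (substAtom xs r A)) (atomF-positive (substAtom xs r A)) K⊆I ∷ bodyFs-FTExact K⊆I Bs exact
  bodyFs-FTExact K⊆I (lit (symb (neg A)) ∷ Bs) (_ ∷ exact) =
    ¬positive-FTExact (atomF (substAtom xs r A)) (atomF-positive (substAtom xs r A)) K⊆I ∷ bodyFs-FTExact K⊆I Bs exact
  bodyFs-FTExact K⊆I (lit (cmp _ _ _) ∷ Bs) (_ ∷ exact) = bodyFs-FTExact K⊆I Bs exact
  bodyFs-FTExact K⊆I (aggP E ∷ Bs) (exactE ∷ exact) =
    aggregate-FTExact E K⊆I (exactE tt) ∷ bodyFs-FTExact K⊆I Bs exact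
  bodyFs-FTExact K⊆I (aggN E ∷ Bs) (exactE ∷ exact) with exactE tt
  ... | inj₂ K≐I = agreeOn-FTExact (¬f (τAgg O (substAgg xs r E))) (substAgg-atoms O xs r E , λ ()) K≐I
                   ∷ bodyFs-FTExact K⊆I Bs exact

-- Minimal counterexamples along the dependency graph

headPredSyms : Program → List PredSym
headPredSyms = concatMap (predSyms ∘ head)

StrictlyReachable : Program → PredSym → PredSym → Set
StrictlyReachable Π p q = Path Π p q × ¬ Path Π q p

StrictlyReachable⇒∈headPredSyms : ∀ {Π p q} → StrictlyReachable Π p q → p ∈ headPredSyms Π
StrictlyReachable⇒∈headPredSyms (ε , ¬qp) = ⊥-elim (¬qp ε)
StrictlyReachable⇒∈headPredSyms ((R , R∈Π , (A , A∈R , refl) , _) ◅ _ , _) =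
  ∈-concatMap⁺ (predSyms ∘ head) (Any.map (λ { refl → ∈-map⁺ predSym A∈R }) R∈Π)

Gap : Interp → Interp → Set
Gap I J = Σ GAtom λ a → I a ≡ true × J a ≡ false

MinimalGap : Program → Interp → Interp → GAtom → Set
MinimalGap Π I J a = I a ≡ true × J a ≡ false ×
                     (∀ g → StrictlyReachable Π (gpred a) (gpred g) → I g ≡ true → J g ≡ true)

module _ (em : ExcludedMiddle 0ℓ) where

  countWhere : ∀ {A : Set} → (A → Set) → List A → ℕ
  countWhere P []       = 0
  countWhere P (x ∷ xs) with em {P x}
  ... | yes _ = suc (countWhere P xs)
  ... | no  _ = countWhere P xs

  countWhere-mono : ∀ {A : Set} {P Q : A → Set} → P ⊆ Q → ∀ xs → countWhere P xs ≤ countWhere Q xs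
  countWhere-mono P⊆Q [] = z≤n
  countWhere-mono {P = P} {Q} P⊆Q (x ∷ xs) with em {P x} | em {Q x}
  ... | yes _ | yes _  = s≤s (countWhere-mono P⊆Q xs)
  ... | yes p | no ¬q  = ⊥-elim (¬q (P⊆Q p))
  ... | no _  | yes _  = m≤n⇒m≤1+n (countWhere-mono P⊆Q xs)
  ... | no _  | no _   = countWhere-mono P⊆Q xs

  countWhere-mono-< : ∀ {A : Set} {P Q : A → Set} {y} → P ⊆ Q →
                      ∀ xs → y ∈ xs → Q y → ¬ P y → countWhere P xs < countWhere Q xs
  countWhere-mono-< {P = P} {Q} P⊆Q (x ∷ xs) y∈ qy ¬py with em {P x} | em {Q x} | y∈
  ... | yes p | no ¬q | _         = ⊥-elim (¬q (P⊆Q p))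
  ... | yes p | _     | here refl = ⊥-elim (¬py p)
  ... | no _  | no ¬q | here refl = ⊥-elim (¬q qy)
  ... | no _  | yes _ | here refl = s≤s (countWhere-mono P⊆Q xs)
  ... | yes _ | yes _ | there y∈′ = s≤s (countWhere-mono-< P⊆Q xs y∈′ qy ¬py)
  ... | no _  | yes _ | there y∈′ = m≤n⇒m≤1+n (countWhere-mono-< P⊆Q xs y∈′ qy ¬py)
  ... | no _  | no _  | there y∈′ = countWhere-mono-< P⊆Q xs y∈′ qy ¬py

  reachableHeads : Program → PredSym → ℕ
  reachableHeads Π p = countWhere (Path Π p) (headPredSyms Π)

  reachableHeads-< : ∀ {Π p q} → StrictlyReachable Π p q → reachableHeads Π q < reachableHeads Π p
  reachableHeads-< {Π} p↝q@(p→q , ¬q→p) =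
    countWhere-mono-< (p→q ◅◅_) (headPredSyms Π) (StrictlyReachable⇒∈headPredSyms p↝q) ε ¬q→p

  minimalGap : ∀ Π {I J} → Gap I J → Σ GAtom (MinimalGap Π I J)
  minimalGap Π {I} {J} (a , Ia , Ja) = descend a (<-wellFounded _) Ia Ja
    where
      descend : ∀ a → Acc _<_ (reachableHeads Π (gpred a)) → I a ≡ true → J a ≡ false →
                Σ GAtom (MinimalGap Π I J)
      descend a (acc below) Ia Ja
        with em {Σ GAtom λ g → StrictlyReachable Π (gpred a) (gpred g) × I g ≡ true × J g ≡ false}
      ... | yes (g , a↝g , Ig , Jg) = descend g (below (reachableHeads-< a↝g)) Ig Jg
      ... | no noGap = a , Ia , Ja , closed
        where
          closed : ∀ g → StrictlyReachable Π (gpred a) (gpred g) → I g ≡ true → J g ≡ true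
          closed g a↝g Ig with J g in Jg
          ... | true  = refl
          ... | false = ⊥-elim (noGap (g , a↝g , Ig , Jg))

heads-predSyms : ∀ xs r As →
                 All (λ h → gpred h ∈ predSyms As) (mapMaybe evalAtom (List.map (substAtom xs r) As))
heads-predSyms xs r [] = []
heads-predSyms xs r (A ∷ As) with evalAtom (substAtom xs r A) in e
... | just h  = here (trans (evalAtom-predSym (substAtom xs r A) e) (substAtom-predSym xs r A))
                ∷ All.map there (heads-predSyms xs r As)
... | nothing = All.map there (heads-predSyms xs r As)

⊨disj-atm⇒Any : ∀ {K} hs → K ⊨ disj (List.map atm hs) → Any (λ h → K h ≡ true) hs
⊨disj-atm⇒Any (h ∷ hs) (zero , Kh)  = here Kh
⊨disj-atm⇒Any (h ∷ hs) (suc i , Kh) = there (⊨disj-atm⇒Any hs (i , Kh))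

Any⇒⊨disj-atm : ∀ {K} hs → Any (λ h → K h ≡ true) hs → K ⊨ disj (List.map atm hs)
Any⇒⊨disj-atm (h ∷ hs) (here Kh)   = zero , Kh
Any⇒⊨disj-atm (h ∷ hs) (there any) = let i , Kh = Any⇒⊨disj-atm hs any in suc i , Kh

disj-atm-positive : ∀ hs → Positive (disj (List.map atm hs))
disj-atm-positive (h ∷ hs) zero    = tt
disj-atm-positive (h ∷ hs) (suc i) = disj-atm-positive hs i

module Instances (O : TermOrder) (Π : Program) where

  Instance : Set
  Instance = Σ (Σ Rule (_∈ Π)) λ (R , _) → RuleInst O (τAgg O) R

  ruleOf : Instance → Rule
  ruleOf ((R , _) , _) = R

  bodyF bodyF₁ : Instance → Formula
  bodyF  ((R , _) , r , _) = conj (bodyFs (τAgg O)  (List.map (substBL (globalVars R) r) (body R)))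
  bodyF₁ ((R , _) , r , _) = conj (bodyFs (τ₁Agg O) (List.map (substBL (globalVars R) r) (body R)))

  headAtoms : Instance → List GAtom
  headAtoms ((R , _) , r , _) = mapMaybe evalAtom (List.map (substAtom (globalVars R) r) (head R))

  headF : Instance → Formula
  headF i = disj (List.map atm (headAtoms i))

  headF-positive : ∀ i → Positive (headF i)
  headF-positive i = disj-atm-positive (headAtoms i)

  bodyF₁⇔bodyF : ExcludedMiddle 0ℓ → ∀ i K → K ⊨ bodyF₁ i ⇔ K ⊨ bodyF i
  bodyF₁⇔bodyF em ((R , _) , r , _) K = body-τ₁⇔τ em O K (List.map (substBL (globalVars R) r) (body R))

  bodyF-agreeOn : ∀ i {K J} → AgreeOn (λ g → gpred g ∈ bodyPredSyms (body (ruleOf i))) K J →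
                  K ⊨ bodyF i → J ⊨ bodyF i
  bodyF-agreeOn i@((R , _) , r , _) K≐J =
    to (⊨-agreeOn (bodyF i) (lookup-All (bodyFs-atoms O (globalVars R) r (body R))) K≐J)

  bodyF-FTExact : ∀ i {K I} → K ⊆I I → All (ExactLit K I) (body (ruleOf i)) → FTExact K I (bodyF i)
  bodyF-FTExact ((R , _) , r , _) K⊆I exact =
    ⋀-FTExact _ (lookup-All (bodyFs-FTExact O (globalVars R) r K⊆I (body R) exact))

  Reached : PredSym → Instance → Set
  Reached q i = Σ GAtom λ h → h ∈ headAtoms i × Path Π q (gpred h)

-- Repairing a proper submodel of one reduct into one of the other

module Repair (em : ExcludedMiddle 0ℓ) (O : TermOrder) (Π : Program)
              (recursive⇒positive : RecursiveAggsPositive Π) {I : Interp} (I⊨τΠ : I ⊨s τProg O Π)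
              {J : Interp} (J⊆I : J ⊆I I) {a : GAtom} (gap : MinimalGap Π I J a) where

  open Instances O Π

  private
    q : PredSym
    q = gpred a

  J′ : Interp
  J′ g = if isYes (em {Path Π q (gpred g)}) then J g else I g

  J′-reached : ∀ g → Path Π q (gpred g) → J′ g ≡ J g
  J′-reached g q↝g with em {Path Π q (gpred g)}
  ... | yes _   = refl
  ... | no ¬q↝g = ⊥-elim (¬q↝g q↝g)

  J′-unreached : ∀ g → ¬ Path Π q (gpred g) → J′ g ≡ I g
  J′-unreached g ¬q↝g with em {Path Π q (gpred g)}
  ... | yes q↝g = ⊥-elim (¬q↝g q↝g)
  ... | no _    = refl

  J′⊆I : J′ ⊆I I
  J′⊆I g with em {Path Π q (gpred g)}
  ... | yes _ = J⊆I g
  ... | no _  = λ Ig → Ig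

  J⊆J′ : J ⊆I J′
  J⊆J′ g with em {Path Π q (gpred g)}
  ... | yes _ = λ Jg → Jg
  ... | no _  = J⊆I g

  J′-gap : Gap I J′
  J′-gap = a , proj₁ gap , trans (J′-reached a ε) (proj₁ (proj₂ gap))

  J-below : ∀ g → StrictlyReachable Π q (gpred g) → J g ≡ I g
  J-below g q↝g = ⇔→≡ (mk⇔ (J⊆I g) (proj₂ (proj₂ gap) g q↝g))

  J′-below : ∀ g → StrictlyReachable Π q (gpred g) → J′ g ≡ I g
  J′-below g q↝g = trans (J′-reached g (proj₁ q↝g)) (J-below g q↝g)

  reached-head : ∀ i → Reached q i → Σ Atom λ A → A ∈ head (ruleOf i) × Path Π q (predSym A)
  reached-head ((R , _) , r , _) (h , h∈ , q↝h) =
    let A , A∈R , h≡A = ∈-map⁻ predSym (All.lookup (heads-predSyms (globalVars R) r (head R)) h∈)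
    in A , A∈R , subst (Path Π q) h≡A q↝h

  reached-body : ∀ i → Reached q i → ∀ {p} → p ∈ bodyPredSyms (body (ruleOf i)) → Path Π q p
  reached-body i@((R , R∈Π) , _) reached p∈
    with reached-head i reached | ∈-map⁻ predSym (subst (_ ∈_) (sym (map-concatMap predSym atomsBL (body R))) p∈)
  ... | A , A∈R , q↝A | b , b∈R , refl = q↝A ◅◅ (R , R∈Π , (A , A∈R , refl) , (b , b∈R , refl)) ◅ ε

  reached-J′≐J : ∀ i → Reached q i → AgreeOn (λ g → gpred g ∈ bodyPredSyms (body (ruleOf i))) J′ J
  reached-J′≐J i reached g g∈ = J′-reached g (reached-body i reached g∈)

  reached-exact : ∀ {K} → (∀ g → StrictlyReachable Π q (gpred g) → K g ≡ I g) →
                  ∀ i → Reached q i → All (ExactLit K I) (body (ruleOf i))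
  reached-exact K-below i@((R , R∈Π) , _) reached = All.tabulate exact
    where
      exact : ∀ {B} → B ∈ body R → ExactLit _ I B
      exact {B} B∈R isAgg with em {RecursiveOcc Π R B}
      ... | yes recursive = inj₁ (recursive⇒positive R R∈Π B B∈R isAgg recursive)
      ... | no ¬recursive = inj₂ λ g g∈B → K-below g (q↝g g g∈B , ¬recursive ∘ recursion g g∈B)
        where
          q↝g : ∀ g → gpred g ∈ predSyms (atomsBL B) → Path Π q (gpred g)
          q↝g g g∈B =
            reached-body i reached (∈-concatMap⁺ (predSyms ∘ atomsBL) (Any.map (λ { refl → g∈B }) B∈R))
          recursion : ∀ g → gpred g ∈ predSyms (atomsBL B) → Path Π (gpred g) q → RecursiveOcc Π R B
          recursion g g∈B g↝q with reached-head i reached | ∈-map⁻ predSym g∈B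
          ... | A , A∈R , q↝A | b , b∈B , g≡b =
            b , b∈B , A , A∈R , subst (λ p → Path Π p (predSym A)) g≡b (g↝q ◅◅ q↝A)

  J′-head : ∀ i → I ⊨ bodyF i → (Reached q i → J′ ⊨ headF i) → J′ ⊨ headF i
  J′-head i I⊨B reachedCase with find (⊨disj-atm⇒Any (headAtoms i) (I⊨τΠ i I⊨B))
  ... | h , h∈ , Ih with em {Path Π q (gpred h)}
  ...   | yes q↝h = reachedCase (h , h∈ , q↝h)
  ...   | no ¬q↝h = Any⇒⊨disj-atm (headAtoms i) (lose h∈ (trans (J′-unreached h ¬q↝h) Ih))

  J′-FLP-model : J ⊨s FTReduct (τProg O Π) I → J′ ⊨s FLPReduct (τ₁Prog O Π) I
  J′-FLP-model J⊨FT (i , I⊨B₁) J′⊨B₁ = J′-head i I⊨B reachedCase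
    where
      I⊨B : I ⊨ bodyF i
      I⊨B = to (bodyF₁⇔bodyF em i I) I⊨B₁
      reachedCase : Reached q i → J′ ⊨ headF i
      reachedCase reached = positive-mono (headF i) (headF-positive i) J⊆J′
                              (to (FT-positive (headF i) (headF-positive i) J⊆I) (proj₂ (J⊨FT i) J⊨FTB))
        where
          J⊨B : J ⊨ bodyF i
          J⊨B = bodyF-agreeOn i (reached-J′≐J i reached) (to (bodyF₁⇔bodyF em i J′) J′⊨B₁)
          J⊨FTB : J ⊨ FT (bodyF i) I
          J⊨FTB = from (bodyF-FTExact i J⊆I (reached-exact J-below i reached)) (I⊨B , J⊨B)

  J′-FT-model : J ⊨s FLPReduct (τ₁Prog O Π) I → J′ ⊨s FTReduct (τProg O Π) I
  J′-FT-model J⊨FLP i = I⊨τΠ i , λ J′⊨FTB →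
    from (FT-positive (headF i) (headF-positive i) J′⊆I)
         (J′-head i (FT-sound (bodyF i) J′⊆I J′⊨FTB) (reachedCase J′⊨FTB))
    where
      reachedCase : J′ ⊨ FT (bodyF i) I → Reached q i → J′ ⊨ headF i
      reachedCase J′⊨FTB reached =
        positive-mono (headF i) (headF-positive i) J⊆J′
          (J⊨FLP (i , from (bodyF₁⇔bodyF em i I) I⊨B) (from (bodyF₁⇔bodyF em i J) J⊨B))
        where
          I⊨B×J′⊨B : I ⊨ bodyF i × J′ ⊨ bodyF i
          I⊨B×J′⊨B = to (bodyF-FTExact i J′⊆I (reached-exact J′-below i reached)) J′⊨FTB
          I⊨B : I ⊨ bodyF i
          I⊨B = proj₁ I⊨B×J′⊨B
          J⊨B : J ⊨ bodyF i
          J⊨B = bodyF-agreeOn i (reached-J′≐J i reached) (proj₂ I⊨B×J′⊨B)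

FTReduct-model⇒model : ∀ H {I} → I ⊨s FTReduct H I → I ⊨s H
FTReduct-model⇒model H I⊨FT i = FT-sound (elem H i) ⊆I-refl (I⊨FT i)

FLPReduct-model⇔FTReduct-model : ExcludedMiddle 0ℓ → ∀ O Π I →
                                 I ⊨s FLPReduct (τ₁Prog O Π) I ⇔ I ⊨s FTReduct (τProg O Π) I
FLPReduct-model⇔FTReduct-model em O Π I = mk⇔
  (λ I⊨FLP i → FT-self (bodyF i ⇒ headF i) λ I⊨B →
     let I⊨B₁ = from (bodyF₁⇔bodyF em i I) I⊨B in I⊨FLP (i , I⊨B₁) I⊨B₁)
  (λ I⊨FT (i , I⊨B₁) _ → FTReduct-model⇒model (τProg O Π) I⊨FT i (to (bodyF₁⇔bodyF em i I) I⊨B₁))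
  where open Instances O Π

Shrinks : FormulaSet → FormulaSet → Interp → Set
Shrinks H G I = ∀ {J} → J ⊆I I → J ⊨s H → Gap I J →
                Σ Interp λ J′ → J′ ⊆I I × J′ ⊨s G × Gap I J′

minimal-transfer : ∀ H G {I} → Shrinks H G I →
                   (∀ J → J ⊆I I → J ⊨s G → I ⊆I J) → ∀ J → J ⊆I I → J ⊨s H → I ⊆I J
minimal-transfer _ _ shrink minimalG J J⊆I J⊨H g Ig with J g in Jg
... | true  = refl
... | false =
  let J′ , J′⊆I , J′⊨G , a , Ia , J′a = shrink J⊆I J⊨H (g , Ig , Jg)
  in ⊥-elim (false≢true (trans (sym J′a) (minimalG J′ J′⊆I J′⊨G a Ia)))

module _ (em : ExcludedMiddle 0ℓ) (O : TermOrder) (Π : Program) (recursive⇒positive : RecursiveAggsPositive Π)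
         {I : Interp} (I⊨τΠ : I ⊨s τProg O Π) where

  shrink-FT⇒FLP : Shrinks (FTReduct (τProg O Π) I) (FLPReduct (τ₁Prog O Π) I) I
  shrink-FT⇒FLP J⊆I J⊨FT gapJ = R.J′ , R.J′⊆I , R.J′-FLP-model J⊨FT , R.J′-gap
    where module R = Repair em O Π recursive⇒positive I⊨τΠ J⊆I (proj₂ (minimalGap em Π gapJ))

  shrink-FLP⇒FT : Shrinks (FLPReduct (τ₁Prog O Π) I) (FTReduct (τProg O Π) I) I
  shrink-FLP⇒FT J⊆I J⊨FLP gapJ = R.J′ , R.J′⊆I , R.J′-FT-model J⊨FLP , R.J′-gap
    where module R = Repair em O Π recursive⇒positive I⊨τΠ J⊆I (proj₂ (minimalGap em Π gapJ))

mainTheorem1 : ExcludedMiddle 0ℓ → (O : TermOrder) → (Π : Program) →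
    RecursiveAggsPositive Π → (I : Interp) → FLPStable O Π I ⇔ FTStable O Π I
mainTheorem1 em O Π recursive⇒positive I = mk⇔ FLP⇒FT FT⇒FLP
  where
    models : I ⊨s FLPReduct (τ₁Prog O Π) I ⇔ I ⊨s FTReduct (τProg O Π) I
    models = FLPReduct-model⇔FTReduct-model em O Π I

    FLP⇒FT : FLPStable O Π I → FTStable O Π I
    FLP⇒FT (I⊨FLP , minimalFLP) =
      let I⊨FT = to models I⊨FLP
          shrink = shrink-FT⇒FLP em O Π recursive⇒positive (FTReduct-model⇒model (τProg O Π) I⊨FT)
      in I⊨FT , minimal-transfer (FTReduct (τProg O Π) I) (FLPReduct (τ₁Prog O Π) I) shrink minimalFLP

    FT⇒FLP : FTStable O Π I → FLPStable O Π I
    FT⇒FLP (I⊨FT , minimalFT) =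
      let shrink = shrink-FLP⇒FT em O Π recursive⇒positive (FTReduct-model⇒model (τProg O Π) I⊨FT)
      in from models I⊨FT , minimal-transfer (FLPReduct (τ₁Prog O Π) I) (FTReduct (τProg O Π) I) shrink minimalFT
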